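{- If $G$ is a graph whose longest path has length $p$ and $H$ is the clique substitution of $G$, then $H$ is $P_{2p+1}$-free.
   Context: The length of a path is its number of vertices. The clique substitution $H$ of a graph $G=(V,E)$ is defined as follows: for each $v\in V$, $H$ contains a clique $K^v$ with vertex set $\{(v,u): u \in N_G(v)\}$ (pairwise vertex-disjoint), and for each edge $uv\in E$, $H$ contains the edge $(v,u)(u,v)$; there are no other edges. $P_t$ is the path on $t$ vertices; $P_t$-free means no induced subgraph isomorphic to $P_t$. -}

module Defs where

open import Data.Nat using (ℕ; suc; _≤_)
open import Data.Fin using (Fin; toℕ)
open import Data.Bool using (Bool; true; false)
open import Data.Product using (Σ; _×_; _,_)
open import Data.Sum using (_⊎_)
open import Relation.Binary.PropositionalEquality using (_≡_)
open import Relation.Nullary using (¬_)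
open import Function.Definitions using (Injective)
open import Function.Bundles using (_⇔_)

record Graph (n : ℕ) : Set where
  field
    adj    : Fin n → Fin n → Bool
    sym    : ∀ u v → adj u v ≡ adj v u
    irrefl : ∀ v → adj v v ≡ false

open Graph public

Adj : ∀ {n} → Graph n → Fin n → Fin n → Set
Adj G u v = adj G u v ≡ true

IsPath : ∀ {n t} → Graph n → (Fin t → Fin n) → Set
IsPath {t = t} G f =
  Injective _≡_ _≡_ f × (∀ (i j : Fin t) → suc (toℕ i) ≡ toℕ j → Adj G (f i) (f j))

HasPath : ∀ {n} → Graph n → ℕ → Set
HasPath {n} G t = Σ (Fin t → Fin n) (IsPath G)

-- The longest path of G has length p (length = number of vertices).
LongestPathLength : ∀ {n} → Graph n → ℕ → Set
LongestPathLength G p = HasPath G p × (∀ t → HasPath G t → t ≤ p)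

IsInducedPath : {V : Set} → (V → V → Set) → (t : ℕ) → (Fin t → V) → Set
IsInducedPath R t f =
  Injective _≡_ _≡_ f ×
  (∀ (i j : Fin t) → R (f i) (f j) ⇔ (suc (toℕ i) ≡ toℕ j ⊎ suc (toℕ j) ≡ toℕ i))

PFree : {V : Set} → (V → V → Set) → ℕ → Set
PFree {V} R t = ¬ Σ (Fin t → V) (IsInducedPath R t)

-- Clique substitution H of G: vertices (v,u) with u ∈ N_G(v).
CSVertex : ∀ {n} → Graph n → Set
CSVertex {n} G = Σ (Fin n × Fin n) (λ { (v , u) → Adj G v u })

-- (v,u) ~ (v',u')  iff  same clique K^v (v = v', u ≠ u'),
-- or they form the edge (v,u)(u,v).
CSAdj : ∀ {n} (G : Graph n) → CSVertex G → CSVertex G → Set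
CSAdj G ((v , u) , _) ((v' , u') , _) = (v ≡ v' × ¬ u ≡ u') ⊎ (v' ≡ u × u' ≡ v)

{-# OPTIONS --safe #-}
module Submission where

open import Defs hiding (sym)
open import Data.Nat using (ℕ; zero; suc; _*_; _≤_; _<_; _≤′_; ≤′-refl; ≤′-step; z≤n; s≤s; s≤s⁻¹)
open import Data.Nat.Properties
open import Data.Fin using (Fin; toℕ; fromℕ<)
open import Data.Fin.Properties using (toℕ-fromℕ<; toℕ-injective; toℕ<n)
open import Data.Bool.Properties using () renaming (_≟_ to _≟ᵇ_)
open import Data.Product using (Σ; _×_; _,_; proj₁; proj₂)
open import Data.Sum using (_⊎_; inj₁; inj₂)
open import Data.Empty using (⊥-elim)
open import Function using (_∘_)
open import Function.Bundles using (Equivalence; _⇔_)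
open import Function.Definitions using (Injective)
open import Relation.Binary.Definitions using (DecidableEquality; tri<; tri≈; tri>)
open import Relation.Binary.PropositionalEquality
open import Relation.Nullary using (¬_; yes; no)
open import Axiom.UniquenessOfIdentityProofs using (module Decidable⇒UIP)

-- Follow an induced path x₀ … x₂ₚ of H and record the clique K^{wᵢ}
-- containing xᵢ.  Consecutive xᵢ lie in the same clique or in
-- cliques of adjacent vertices of G, and two path vertices in one clique are
-- adjacent in H, hence consecutive on the induced path.  So each clique is
-- visited at most twice, in consecutive steps, and deleting the repetitions
-- from w₀ … w₂ₚ leaves a path of G on at least p + 1 vertices.

module WalkCompression
  {V : Set} (_≟_ : DecidableEquality V) (R : V → V → Set) (m : ℕ) (w : ℕ → V)
  (stay-or-move : ∀ {i} → suc i ≤ m → w i ≡ w (suc i) ⊎ R (w i) (w (suc i)))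
  (repeat⇒consecutive : ∀ {i j} → i < j → j ≤ m → w i ≡ w j → j ≡ suc i)
  where

  move : ∀ {i} → suc i ≤ m → ¬ w i ≡ w (suc i) → R (w i) (w (suc i))
  move i+1≤m w≢ with stay-or-move i+1≤m
  ... | inj₁ w≡ = ⊥-elim (w≢ w≡)
  ... | inj₂ r  = r

  no-repeat-two-apart : ∀ {i} → suc (suc i) ≤ m → ¬ w i ≡ w (suc (suc i))
  no-repeat-two-apart i+2≤m w≡ = 1+n≢n (suc-injective (repeat⇒consecutive (n≤1+n _) i+2≤m w≡))

  next : ℕ → ℕ
  next i with w i ≟ w (suc i)
  ... | yes _ = suc (suc i)
  ... | no _  = suc i

  <-next : ∀ i → i < next i
  <-next i with w i ≟ w (suc i)
  ... | yes _ = m≤n⇒m≤1+n ≤-refl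
  ... | no _  = ≤-refl

  next-≤ : ∀ i → next i ≤ suc (suc i)
  next-≤ i with w i ≟ w (suc i)
  ... | yes _ = ≤-refl
  ... | no _  = n≤1+n _

  next-move : ∀ i → next i ≤ m → ¬ w i ≡ w (next i) × R (w i) (w (next i))
  next-move i next≤m with w i ≟ w (suc i)
  ... | yes w≡ = w≢ , subst (λ x → R x (w (suc (suc i)))) (sym w≡) (move next≤m (w≢ ∘ trans w≡))
    where
    w≢ : ¬ w i ≡ w (suc (suc i))
    w≢ = no-repeat-two-apart next≤m
  ... | no w≢  = w≢ , move next≤m w≢

  pick : ℕ → ℕ
  pick zero    = zero
  pick (suc k) = next (pick k)

  pick-≤ : ∀ k → pick k ≤ 2 * k
  pick-≤ zero    = z≤n
  pick-≤ (suc k) = begin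
    next (pick k)         ≤⟨ next-≤ (pick k) ⟩
    suc (suc (pick k))    ≤⟨ s≤s (s≤s (pick-≤ k)) ⟩
    suc (suc (2 * k))     ≡⟨ *-suc 2 k ⟨
    2 * suc k             ∎
    where open ≤-Reasoning

  pick-mono : ∀ {a b} → a ≤ b → pick a ≤ pick b
  pick-mono = mono′ ∘ ≤⇒≤′
    where
    mono′ : ∀ {a b} → a ≤′ b → pick a ≤ pick b
    mono′ ≤′-refl       = ≤-refl
    mono′ (≤′-step a≤b) = ≤-trans (mono′ a≤b) (<⇒≤ (<-next _))

  pick-strict : ∀ {a b} → a < b → pick a < pick b
  pick-strict {a} a<b = <-≤-trans (<-next (pick a)) (pick-mono a<b)

  pick-move : ∀ k → 2 * suc k ≤ m → ¬ w (pick k) ≡ w (pick (suc k)) × R (w (pick k)) (w (pick (suc k)))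
  pick-move k 2k+2≤m = next-move (pick k) (≤-trans (pick-≤ (suc k)) 2k+2≤m)

  pick-distinct : ∀ {a b} → a < b → 2 * b ≤ m → ¬ w (pick a) ≡ w (pick b)
  pick-distinct {a} {b} a<b 2b≤m w≡ =
    proj₁ (pick-move a (≤-trans (*-monoʳ-≤ 2 a<b) 2b≤m)) (trans w≡ (cong w (sym pick-suc≡)))
    where
    pick-b≡ : pick b ≡ suc (pick a)
    pick-b≡ = repeat⇒consecutive (pick-strict a<b) (≤-trans (pick-≤ b) 2b≤m) w≡
    pick-suc≡ : pick (suc a) ≡ pick b
    pick-suc≡ = ≤-antisym (pick-mono a<b) (subst (_≤ next (pick a)) (sym pick-b≡) (<-next (pick a)))

  pick-injective : ∀ {p a b} → 2 * p ≤ m → a ≤ p → b ≤ p → w (pick a) ≡ w (pick b) → a ≡ b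
  pick-injective {a = a} {b} 2p≤m a≤p b≤p w≡ with <-cmp a b
  ... | tri< a<b _ _ = ⊥-elim (pick-distinct a<b (≤-trans (*-monoʳ-≤ 2 b≤p) 2p≤m) w≡)
  ... | tri≈ _ a≡b _ = a≡b
  ... | tri> _ _ b<a = ⊥-elim (pick-distinct b<a (≤-trans (*-monoʳ-≤ 2 a≤p) 2p≤m) (sym w≡))

  path : ∀ p → 2 * p ≤ m →
    Σ (Fin (suc p) → V) λ g → Injective _≡_ _≡_ g × (∀ i j → suc (toℕ i) ≡ toℕ j → R (g i) (g j))
  path p 2p≤m = g , g-injective , g-adjacent
    where
    g : Fin (suc p) → V
    g k = w (pick (toℕ k))

    toℕ≤p : ∀ (k : Fin (suc p)) → toℕ k ≤ p
    toℕ≤p k = s≤s⁻¹ (toℕ<n k)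

    g-injective : Injective _≡_ _≡_ g
    g-injective {i} {j} = toℕ-injective ∘ pick-injective 2p≤m (toℕ≤p i) (toℕ≤p j)

    g-adjacent : ∀ i j → suc (toℕ i) ≡ toℕ j → R (g i) (g j)
    g-adjacent i j i+1≡j = subst (λ k → R (g i) (w (pick k))) i+1≡j
      (proj₂ (pick-move (toℕ i) (≤-trans (*-monoʳ-≤ 2 (subst (_≤ p) (sym i+1≡j) (toℕ≤p j))) 2p≤m)))

-- Reads a path indexed by Fin (suc m) as a sequence on ℕ; indices beyond m
-- are clamped to m and never used.
clamp : ∀ m → ℕ → Fin (suc m)
clamp m i = fromℕ< (s≤s (m⊓n≤n i m))

toℕ-clamp : ∀ {m i} → i ≤ m → toℕ (clamp m i) ≡ i
toℕ-clamp i≤m = trans (toℕ-fromℕ< _) (m≤n⇒m⊓n≡m i≤m)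

module InducedPathOnℕ
  {X : Set} (R : X → X → Set) {m : ℕ}
  (f : Fin (suc m) → X) (induced : IsInducedPath R (suc m) f)
  where

  at : ℕ → X
  at = f ∘ clamp m

  at-injective : ∀ {i j} → i ≤ m → j ≤ m → at i ≡ at j → i ≡ j
  at-injective i≤m j≤m at≡ =
    trans (sym (toℕ-clamp i≤m)) (trans (cong toℕ (proj₁ induced at≡)) (toℕ-clamp j≤m))

  at-adjacency : ∀ {i j} → i ≤ m → j ≤ m → R (at i) (at j) ⇔ (suc i ≡ j ⊎ suc j ≡ i)
  at-adjacency {i} {j} i≤m j≤m =
    subst₂ (λ a b → R (at i) (at j) ⇔ (suc a ≡ b ⊎ suc b ≡ a))
      (toℕ-clamp i≤m) (toℕ-clamp j≤m) (proj₂ induced (clamp m i) (clamp m j))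

  at-adjacent : ∀ {i} → suc i ≤ m → R (at i) (at (suc i))
  at-adjacent i+1≤m = Equivalence.from (at-adjacency (<⇒≤ i+1≤m) i+1≤m) (inj₁ refl)

  at-far : ∀ {i j} → i < j → j ≤ m → R (at i) (at j) → j ≡ suc i
  at-far i<j j≤m r with Equivalence.to (at-adjacency (<⇒≤ (<-≤-trans i<j j≤m)) j≤m) r
  ... | inj₁ i+1≡j = sym i+1≡j
  ... | inj₂ j+1≡i = ⊥-elim (<-asym i<j (≤-reflexive j+1≡i))

module CliqueSubstitution {n : ℕ} (G : Graph n) where

  clique : CSVertex G → Fin n
  clique ((v , _) , _) = v

  CSVertex-≡ : ∀ {x y : CSVertex G} → proj₁ x ≡ proj₁ y → x ≡ y
  CSVertex-≡ {(vu , x)} {(.vu , y)} refl = cong (vu ,_) (Decidable⇒UIP.≡-irrelevant _≟ᵇ_ x y)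

  CSAdj⇒clique-≡⊎Adj : ∀ x y → CSAdj G x y → clique x ≡ clique y ⊎ Adj G (clique x) (clique y)
  CSAdj⇒clique-≡⊎Adj _ _ (inj₁ (v≡v′ , _)) = inj₁ v≡v′
  CSAdj⇒clique-≡⊎Adj ((v , u) , vu) _ (inj₂ (v′≡u , _)) = inj₂ (subst (Adj G v) (sym v′≡u) vu)

  same-clique⇒CSAdj : ∀ x y → clique x ≡ clique y → ¬ x ≡ y → CSAdj G x y
  same-clique⇒CSAdj _ _ v≡v′ x≢y = inj₁ (v≡v′ , λ u≡u′ → x≢y (CSVertex-≡ (cong₂ _,_ v≡v′ u≡u′)))

lemma4p3 : ∀ {n} (G : Graph n) (p : ℕ) → LongestPathLength G p →
    PFree (CSAdj G) (suc (2 * p))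
lemma4p3 G p (_ , longest) (f , induced) = 1+n≰n (longest (suc p) (path p ≤-refl))
  where
  open InducedPathOnℕ (CSAdj G) f induced
  open CliqueSubstitution G

  w : ℕ → Fin _
  w = clique ∘ at

  stay-or-move : ∀ {i} → suc i ≤ 2 * p → w i ≡ w (suc i) ⊎ Adj G (w i) (w (suc i))
  stay-or-move {i} i+1≤2p = CSAdj⇒clique-≡⊎Adj (at i) (at (suc i)) (at-adjacent i+1≤2p)

  repeat⇒consecutive : ∀ {i j} → i < j → j ≤ 2 * p → w i ≡ w j → j ≡ suc i
  repeat⇒consecutive {i} {j} i<j j≤2p w≡ = at-far i<j j≤2p (same-clique⇒CSAdj (at i) (at j) w≡ at≢)
    where
    at≢ : ¬ at i ≡ at j
    at≢ = <⇒≢ i<j ∘ at-injective (<⇒≤ (<-≤-trans i<j j≤2p)) j≤2p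

  open WalkCompression Data.Fin._≟_ (Adj G) (2 * p) w stay-or-move repeat⇒consecutive
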